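{- Fix integers $n\ge 0$ and $g\ge 0$. There is a bijection between the set of Dyck paths of semilength $n$ and height at most $g+1$ and the set of quadruples $(m,L,R,M)$ such that \begin{itemize} \item $m$ is a non-negative integer, \item $L=(L_1,\dots,L_m)$ is an $m$-tuple of Dyck paths of height at most $\lfloor g/2\rfloor$, \item $R=(R_1,\dots,R_m)$ is an $m$-tuple of Dyck paths of height at most $\lceil g/2\rceil$, \item $M$ is a Dyck path of height at most $\lceil g/2\rceil$ if $m=0$, and of height exactly $\lceil g/2\rceil$ otherwise, \end{itemize} and the sum of the semilengths of $L_1,\dots,L_m,R_1,\dots,R_m,M$ is $n-m$.
   Context: A Dyck path of semilength $k\ge 0$ is a lattice path from $(0,0)$ to $(2k,0)$ with steps $(1,1)$ and $(1,-1)$ never going below the $x$-axis (the empty path is the Dyck path of semilength $0$). Its height is the maximal $y$-coordinate it attains. -}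

module Defs where

open import Data.Bool using (Bool; true; false; _∧_; T)
open import Data.Nat using (ℕ; zero; suc; _+_; _∸_; _≤_; _⊔_; _/_; ⌊_/2⌋; ⌈_/2⌉)
open import Data.List using (List; []; _∷_; length; filter)
open import Data.Vec using (Vec; []; _∷_)
open import Data.Product using (Σ; _×_)
open import Data.Sum using (_⊎_)
open import Relation.Binary.PropositionalEquality using (_≡_)

-- A lattice path with steps (1,1) (= true, up) and (1,-1) (= false, down).
Path : Set
Path = List Bool

isDyckFrom : ℕ → Path → Bool
isDyckFrom zero    []          = true
isDyckFrom (suc _) []          = false
isDyckFrom y       (true  ∷ p) = isDyckFrom (suc y) p
isDyckFrom zero    (false ∷ p) = false
isDyckFrom (suc y) (false ∷ p) = isDyckFrom y p

isDyck : Path → Bool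
isDyck = isDyckFrom zero

-- maximal y-coordinate attained, starting at height y (only meaningful on Dyck paths)
heightFrom : ℕ → Path → ℕ
heightFrom y []          = y
heightFrom y (true  ∷ p) = y ⊔ heightFrom (suc y) p
heightFrom y (false ∷ p) = y ⊔ heightFrom (y ∸ 1) p

height : Path → ℕ
height = heightFrom zero

semilength : Path → ℕ
semilength p = ⌊ length p /2⌋

DyckLe : ℕ → Set
DyckLe h = Σ Path (λ p → T (isDyck p) × height p ≤ h)

DyckNLe : ℕ → ℕ → Set
DyckNLe n h = Σ Path (λ p → T (isDyck p) × (semilength p ≡ n × height p ≤ h))

sumSemilengths : {h : ℕ} {m : ℕ} → Vec (DyckLe h) m → ℕ
sumSemilengths [] = zero
sumSemilengths (d ∷ ds) = semilength (Σ.proj₁ d) + sumSemilengths ds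

MCond : ℕ → ℕ → Path → Set
MCond g zero    p = height p ≤ ⌈ g /2⌉
MCond g (suc _) p = height p ≡ ⌈ g /2⌉

-- Quadruples (m, L, R, M) with total semilength of L,R,M equal to n - m
-- (stated additively as  sum + m ≡ n, so that m ≤ n is enforced).
Quadruple : ℕ → ℕ → Set
Quadruple n g =
  Σ ℕ (λ m →
  Σ (Vec (DyckLe ⌊ g /2⌋) m) (λ L →
  Σ (Vec (DyckLe ⌈ g /2⌉) m) (λ R →
  Σ (Σ Path (λ p → T (isDyck p) × MCond g m p)) (λ M →
    sumSemilengths L + sumSemilengths R + semilength (Σ.proj₁ M) + m ≡ n))))

{-# OPTIONS --safe #-}
-- Put r = ⌈g/2⌉ and l = ⌊g/2⌋, so that P lives in the strip [0, l + 1 + r].  A path P that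
-- never reaches height r goes to (0, [], [], P).  Otherwise P factors as
--   A W₁ ↑ L₁ ↓ W₂ ↑ L₂ ↓ ⋯ Wₘ ↑ Lₘ ↓ B,
-- where A is its first passage to height r, each Wᵢ runs from r to r and B from r to 0 inside
-- [0, r], and each Lᵢ stays inside [r + 1, l + 1 + r].  Then M = A B has height exactly r, Rᵢ
-- is Wᵢ with up and down steps exchanged, and Lᵢ is read relative to r + 1.  The factorisation
-- is unique because every cut is the first point where a path would leave its strip, and each
-- pair ↑ ↓ contributes one to the semilength, which accounts for n − m.
module Submission where

open import Defs
open import Data.Bool using (Bool; true; false; not; T)
open import Data.Bool.Properties using (T-irrelevant; not-involutive)
open import Data.Nat using (ℕ; zero; suc; _+_; _≤_; _<_; z≤n; ⌊_/2⌋; ⌈_/2⌉)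
open import Data.Nat.Properties
open import Data.Nat.Tactic.RingSolver using (solve-∀)
open import Data.List using ([]; _∷_; _++_; length; map)
open import Data.List.Properties
  using (∷-injectiveʳ; ++-assoc; ++-identityʳ; length-++; length-map; map-∘; map-cong; map-id)
open import Data.Vec using (Vec; []; _∷_)
open import Data.Product using (Σ; ∃-syntax; _×_; _,_; proj₁; proj₂)
open import Data.Sum using (_⊎_; inj₁; inj₂)
open import Data.Empty using (⊥-elim)
open import Relation.Nullary using (¬_)
open import Relation.Binary.PropositionalEquality
open import Function.Bundles using (_⤖_; mk↔ₛ′)
open import Function.Properties.Inverse using (↔⇒⤖)

variable
  K K′ k k′ y y′ z z′ n : ℕ
  b : Bool
  p p′ q q′ : Path

-- Within K y z p: p leads from height y to height z without leaving the strip [0, K].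
-- The start height y itself is not required to lie in the strip.
data Within (K : ℕ) : ℕ → ℕ → Path → Set where
  []   : Within K y y []
  up   : y < K → Within K (suc y) z p → Within K y z (true ∷ p)
  down : Within K y z p → Within K (suc y) z (false ∷ p)

within-++ : Within K y z p → Within K z z′ q → Within K y z′ (p ++ q)
within-++ []         w′ = w′
within-++ (up y<K w) w′ = up y<K (within-++ w w′)
within-++ (down w)   w′ = down (within-++ w w′)

within-mono : K ≤ K′ → Within K y z p → Within K′ y z p
within-mono K≤K′ []         = []
within-mono K≤K′ (up y<K w) = up (≤-trans y<K K≤K′) (within-mono K≤K′ w)
within-mono K≤K′ (down w)   = down (within-mono K≤K′ w)

within-shift : ∀ c → Within K y z p → Within (K + c) (y + c) (z + c) p
within-shift c []         = []
within-shift c (up y<K w) = up (+-monoˡ-≤ c y<K) (within-shift c w)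
within-shift c (down w)   = down (within-shift c w)

map-not-involutive : ∀ p → map not (map not p) ≡ p
map-not-involutive p = trans (sym (map-∘ p)) (trans (map-cong not-involutive p) (map-id p))

map-not-injective : map not p ≡ map not p′ → p ≡ p′
map-not-injective {p} {p′} eq =
  trans (sym (map-not-involutive p)) (trans (cong (map not) eq) (map-not-involutive p′))

within-reflect : y + y′ ≡ K → z + z′ ≡ K → Within K y z p → Within K y′ z′ (map not p)
within-reflect {y} {y′} {z′ = z′} e e′ [] with +-cancelˡ-≡ y y′ z′ (trans e (sym e′))
... | refl = []
within-reflect {y} {zero} e e′ (up y<K w) = ⊥-elim (<-irrefl (trans (sym (+-identityʳ y)) e) y<K)
within-reflect {y} {suc y′} e e′ (up y<K w) = down (within-reflect (trans (sym (+-suc y y′)) e) e′ w)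
within-reflect {y = suc y} {y′} {K} e e′ (down w) =
  up (≤-trans (m≤n+m (suc y′) y) (≤-reflexive e″)) (within-reflect e″ e′ w)
  where
  e″ : y + suc y′ ≡ K
  e″ = trans (+-suc y y′) e

within-parity : Within K y z p → ∃[ d ] length p + y ≡ d + d + z
within-parity []       = 0 , refl
within-parity {y = y} (up {p = p} _ w) with within-parity w
... | d , e = d , trans (sym (+-suc (length p) y)) e
within-parity (down {y = y} {z = z} {p = p} w) with within-parity w
... | d , e =
  suc d , cong suc (trans (+-suc (length p) y) (trans (cong suc e) (cong (_+ z) (sym (+-suc d d)))))

⌊k+k+n/2⌋≡k+⌊n/2⌋ : ∀ k n → ⌊ k + k + n /2⌋ ≡ k + ⌊ n /2⌋
⌊k+k+n/2⌋≡k+⌊n/2⌋ zero    n = refl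
⌊k+k+n/2⌋≡k+⌊n/2⌋ (suc k) n rewrite +-suc k k = cong suc (⌊k+k+n/2⌋≡k+⌊n/2⌋ k n)

closed-length : Within K y y p → length p ≡ semilength p + semilength p
closed-length {y = y} {p = p} w with within-parity w
... | d , e =
  trans length≡ (cong (λ s → s + s) (trans (n≡⌊n+n/2⌋ d) (cong ⌊_/2⌋ (sym length≡))))
  where
  length≡ : length p ≡ d + d
  length≡ = +-cancelʳ-≡ y (length p) (d + d) e

Blocked : ℕ → ℕ → Bool → Set
Blocked K z b = ∀ {z′ p} → ¬ Within K z z′ (b ∷ p)

top-blocked : Blocked K K true
top-blocked (up K<K _) = <-irrefl refl K<K

bottom-blocked : Blocked K 0 false
bottom-blocked ()

++-cancel-at-blocked : Blocked K z b → Within K y z p → Within K y z p′ →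
                       p ++ b ∷ q ≡ p′ ++ b ∷ q′ → p ≡ p′ × q ≡ q′
++-cancel-at-blocked bl []          []           eq   = refl , ∷-injectiveʳ eq
++-cancel-at-blocked bl []          w′@(up _ _)  refl = ⊥-elim (bl w′)
++-cancel-at-blocked bl []          w′@(down _)  refl = ⊥-elim (bl w′)
++-cancel-at-blocked bl w@(up _ _)  []           refl = ⊥-elim (bl w)
++-cancel-at-blocked bl w@(down _)  []           refl = ⊥-elim (bl w)
++-cancel-at-blocked bl (up _ w)    (up _ w′)    eq with ++-cancel-at-blocked bl w w′ (∷-injectiveʳ eq)
... | refl , q≡q′ = refl , q≡q′
++-cancel-at-blocked bl (down w)    (down w′)    eq with ++-cancel-at-blocked bl w w′ (∷-injectiveʳ eq)
... | refl , q≡q′ = refl , q≡q′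

blocked-after : Blocked K z b → Within K y z p → ¬ Within K y z′ (p ++ b ∷ q)
blocked-after bl []       w′          = bl w′
blocked-after bl (up _ w) (up _ w′)   = blocked-after bl w w′
blocked-after bl (down w) (down w′)   = blocked-after bl w w′

heightFrom-≥ : ∀ y p → y ≤ heightFrom y p
heightFrom-≥ y []          = ≤-refl
heightFrom-≥ y (true  ∷ p) = m≤m⊔n y _
heightFrom-≥ y (false ∷ p) = m≤m⊔n y _

-- isDyckFrom splits on the start height before it looks at an up step.
isDyckFrom-up : ∀ y p → isDyckFrom y (true ∷ p) ≡ isDyckFrom (suc y) p
isDyckFrom-up zero    p = refl
isDyckFrom-up (suc y) p = refl

within⇒dyck : y ≤ K → Within K y 0 p → T (isDyckFrom y p) × heightFrom y p ≤ K
within⇒dyck y≤K []         = _ , y≤K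
within⇒dyck {y} y≤K (up {p = p} y<K w) with within⇒dyck y<K w
... | d , h≤K = subst T (sym (isDyckFrom-up y p)) d , ⊔-lub y≤K h≤K
within⇒dyck y≤K (down w) with within⇒dyck (<⇒≤ y≤K) w
... | d , h≤K = d , ⊔-lub y≤K h≤K

dyck⇒within : ∀ y p → T (isDyckFrom y p) → heightFrom y p ≤ K → Within K y 0 p
dyck⇒within zero    []          d h≤K = []
dyck⇒within y       (true ∷ p)  d h≤K =
  up (≤-trans (heightFrom-≥ (suc y) p) h′≤K)
     (dyck⇒within (suc y) p (subst T (isDyckFrom-up y p) d) h′≤K)
  where
  h′≤K = ≤-trans (m≤n⊔m y _) h≤K
dyck⇒within (suc y) (false ∷ p) d h≤K = down (dyck⇒within y p d (≤-trans (m≤n⊔m (suc y) _) h≤K))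

DyckLe-≡ : {d d′ : DyckLe K} → proj₁ d ≡ proj₁ d′ → d ≡ d′
DyckLe-≡ {d = p , i , h} {d′ = .p , i′ , h′} refl
  rewrite T-irrelevant i i′ | ≤-irrelevant h h′ = refl

within⇒dyckLe : Within K 0 0 p → DyckLe K
within⇒dyckLe {p = p} w = p , within⇒dyck z≤n w

dyckLe⇒within : (d : DyckLe K) → Within K 0 0 (proj₁ d)
dyckLe⇒within (p , i , h) = dyck⇒within 0 p i h

dyckLe-length : (d : DyckLe K) → length (proj₁ d) ≡ semilength (proj₁ d) + semilength (proj₁ d)
dyckLe-length d = closed-length (dyckLe⇒within d)

DyckNLe-≡ : {x x′ : DyckNLe n K} → proj₁ x ≡ proj₁ x′ → x ≡ x′
DyckNLe-≡ {x = p , i , s , h} {x′ = .p , i′ , s′ , h′} refl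
  rewrite T-irrelevant i i′ | ≡-irrelevant s s′ | ≤-irrelevant h h′ = refl

data FirstPassage (r : ℕ) : ℕ → Path → Set where
  []   : FirstPassage r r []
  up   : y < r → FirstPassage r (suc y) p → FirstPassage r y (true ∷ p)
  down : suc y < r → FirstPassage r y p → FirstPassage r (suc y) (false ∷ p)

firstPassage⇒within : ∀ {r} → FirstPassage r y p → Within r y r p
firstPassage⇒within []         = []
firstPassage⇒within (up y<r f) = up y<r (firstPassage⇒within f)
firstPassage⇒within (down _ f) = down (firstPassage⇒within f)

firstPassage-reaches : ∀ {r} → FirstPassage r y p → r ≤ heightFrom y (p ++ q)
firstPassage-reaches {q = q} []    = heightFrom-≥ _ q
firstPassage-reaches {y} (up _ f)  = ≤-trans (firstPassage-reaches f) (m≤n⊔m y _)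
firstPassage-reaches (down {y} _ f) = ≤-trans (firstPassage-reaches f) (m≤n⊔m (suc y) _)

firstPassage-unique : ∀ {r} → FirstPassage r y p → FirstPassage r y p′ →
                      p ++ q ≡ p′ ++ q′ → p ≡ p′ × q ≡ q′
firstPassage-unique []         []          eq = refl , eq
firstPassage-unique []         (up r<r _)  _  = ⊥-elim (<-irrefl refl r<r)
firstPassage-unique []         (down r<r _) _ = ⊥-elim (<-irrefl refl r<r)
firstPassage-unique (up r<r _) []          _  = ⊥-elim (<-irrefl refl r<r)
firstPassage-unique (down r<r _) []        _  = ⊥-elim (<-irrefl refl r<r)
firstPassage-unique (up _ f)   (up _ f′)   eq with firstPassage-unique f f′ (∷-injectiveʳ eq)
... | refl , q≡q′ = refl , q≡q′
firstPassage-unique (down _ f) (down _ f′) eq with firstPassage-unique f f′ (∷-injectiveʳ eq)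
... | refl , q≡q′ = refl , q≡q′

record FirstVisit (K r y z : ℕ) (p : Path) : Set where
  constructor firstVisit
  field
    {before after} : Path
    first-passage  : FirstPassage r y before
    after-within   : Within K r z after
    splits         : before ++ after ≡ p

open FirstVisit

firstVisit? : ∀ {r} → y ≤ r → Within K y z p → heightFrom y p < r ⊎ FirstVisit K r y z p
firstVisit? y≤r w with m≤n⇒m<n∨m≡n y≤r
firstVisit? _ w          | inj₂ refl = inj₂ (firstVisit [] w refl)
firstVisit? _ []         | inj₁ y<r  = inj₁ y<r
firstVisit? _ (up _ w)   | inj₁ y<r with firstVisit? y<r w
... | inj₁ h<r                  = inj₁ (⊔-pres-<m y<r h<r)
... | inj₂ (firstVisit f w′ eq) = inj₂ (firstVisit (up y<r f) w′ (cong (true ∷_) eq))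
firstVisit? _ (down {y} w) | inj₁ y<r with firstVisit? (≤-trans (n≤1+n y) (<⇒≤ y<r)) w
... | inj₁ h<r                  = inj₁ (⊔-pres-<m y<r h<r)
... | inj₂ (firstVisit f w′ eq) = inj₂ (firstVisit (down y<r f) w′ (cong (false ∷_) eq))

firstVisit-unique : ∀ {r} {a b} (v : FirstVisit K r y z p) → FirstPassage r y a → a ++ b ≡ p →
                    before v ≡ a × after v ≡ b
firstVisit-unique v f eq = firstPassage-unique (first-passage v) f (trans (splits v) (sym eq))

reaches⇒firstVisit : ∀ {r} → r ≤ heightFrom y p → y ≤ r → Within K y z p → FirstVisit K r y z p
reaches⇒firstVisit r≤h y≤r w with firstVisit? y≤r w
... | inj₁ h<r = ⊥-elim (<⇒≱ h<r r≤h)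
... | inj₂ v   = v

module Decomposition (r l : ℕ) where

  H : ℕ
  H = l + suc r

  r<H : r < H
  r<H = m≤n+m (suc r) l

  reflected-within : (d : DyckLe r) → Within r r r (map not (proj₁ d))
  reflected-within d = within-reflect refl refl (dyckLe⇒within d)

  glue : Vec (DyckLe l) k → Vec (DyckLe r) k → Path → Path
  glue []       []       B = B
  glue (L ∷ Ls) (R ∷ Rs) B = map not (proj₁ R) ++ true ∷ proj₁ L ++ false ∷ glue Ls Rs B

  glue-within : (Ls : Vec (DyckLe l) k) (Rs : Vec (DyckLe r) k) →
                Within r r 0 q → Within H r 0 (glue Ls Rs q)
  glue-within []       []       w = within-mono (<⇒≤ r<H) w
  glue-within (L ∷ Ls) (R ∷ Rs) w =
    within-++ (within-mono (<⇒≤ r<H) (reflected-within R))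
      (up r<H
        (within-++ (within-shift (suc r) (dyckLe⇒within L)) (down (glue-within Ls Rs w))))

  record Factorisation (q : Path) : Set where
    constructor factorisation
    field
      {count}     : ℕ
      lefts       : Vec (DyckLe l) count
      rights      : Vec (DyckLe r) count
      {base}      : Path
      base-within : Within r r 0 base
      glued       : glue lefts rights base ≡ q

  reflected-dyckLe : Within r r r p → DyckLe r
  reflected-dyckLe {p} w = map not p , within⇒dyck z≤n (within-reflect (+-identityʳ r) (+-identityʳ r) w)

  -- The accumulator p is the segment below height r read so far; p′ is the part read so far
  -- of the current excursion above r, which is now at height k + r + 1.
  mutual
    factorise : y ≤ r → Within r r y p → Within H y 0 q → Factorisation (p ++ q)
    factorise _ wp [] = factorisation [] [] wp (sym (++-identityʳ _))
    factorise {p = p} {q = false ∷ q} y≤r wp (down wq) =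
      subst Factorisation (++-assoc p (false ∷ []) q)
        (factorise (≤-trans (n≤1+n _) y≤r) (within-++ wp (down [])) wq)
    factorise {p = p} {q = true ∷ q} y≤r wp (up _ wq) with m≤n⇒m<n∨m≡n y≤r
    ... | inj₁ y<r  = subst Factorisation (++-assoc p (true ∷ []) q)
                        (factorise y<r (within-++ wp (up y<r [])) wq)
    ... | inj₂ refl = excursion wp [] wq

    excursion : Within r r r p → Within l 0 k p′ → Within H (k + suc r) 0 q →
                Factorisation (p ++ true ∷ p′ ++ q)
    excursion {p = p} {k} {p′} {true ∷ q} wp wp′ (up k<H wq) =
      subst (λ x → Factorisation (p ++ true ∷ x)) (++-assoc p′ (true ∷ []) q)
        (excursion wp (within-++ wp′ (up (+-cancelʳ-≤ (suc r) (suc k) l k<H) [])) wq)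
    excursion {p = p} {zero} {p′} {false ∷ q} wp wp′ (down wq) with factorise ≤-refl [] wq
    ... | factorisation Ls Rs wB glued =
      factorisation (within⇒dyckLe wp′ ∷ Ls) (reflected-dyckLe wp ∷ Rs) wB
        (cong₂ (λ x y → x ++ true ∷ p′ ++ false ∷ y) (map-not-involutive p) glued)
    excursion {k = zero}  {q = []} _ _ ()
    excursion {k = suc k} {q = []} _ _ ()
    excursion {p = p} {suc k} {p′} {false ∷ q} wp wp′ (down wq) =
      subst (λ x → Factorisation (p ++ true ∷ x)) (++-assoc p′ (false ∷ []) q)
        (excursion wp (within-++ wp′ (down [])) wq)

  Excursions : Set
  Excursions = Σ ℕ (λ k → Vec (DyckLe l) k × Vec (DyckLe r) k)

  glue-escapes : (L : DyckLe l) (R : DyckLe r) (Ls : Vec (DyckLe l) k) (Rs : Vec (DyckLe r) k) →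
                 Within r y r p → ¬ Within r y z (p ++ glue (L ∷ Ls) (R ∷ Rs) q)
  glue-escapes {p = p} L R Ls Rs wp w =
    blocked-after top-blocked (within-++ wp (reflected-within R))
      (subst (Within r _ _) (sym (++-assoc p (map not (proj₁ R)) _)) w)

  glue-injective : (Ls : Vec (DyckLe l) k) (Rs : Vec (DyckLe r) k)
                   (Ls′ : Vec (DyckLe l) k′) (Rs′ : Vec (DyckLe r) k′) →
                   Within r r 0 q → Within r r 0 q′ → glue Ls Rs q ≡ glue Ls′ Rs′ q′ →
                   _≡_ {A = Excursions} (k , Ls , Rs) (k′ , Ls′ , Rs′) × q ≡ q′
  glue-injective []       []       []         []         w w′ eq = refl , eq
  glue-injective []       []       (L′ ∷ Ls′) (R′ ∷ Rs′) w w′ eq =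
    ⊥-elim (glue-escapes L′ R′ Ls′ Rs′ [] (subst (Within r r 0) eq w))
  glue-injective (L ∷ Ls) (R ∷ Rs) []         []         w w′ eq =
    ⊥-elim (glue-escapes L R Ls Rs [] (subst (Within r r 0) (sym eq) w′))
  glue-injective (L ∷ Ls) (R ∷ Rs) (L′ ∷ Ls′) (R′ ∷ Rs′) w w′ eq
    with ++-cancel-at-blocked top-blocked (reflected-within R) (reflected-within R′) eq
  ... | R≡R′ , eq′ with ++-cancel-at-blocked bottom-blocked (dyckLe⇒within L) (dyckLe⇒within L′) eq′
  ... | L≡L′ , eq″ with glue-injective Ls Rs Ls′ Rs′ w w′ eq″
                      | DyckLe-≡ {d = L} {L′} L≡L′
                      | DyckLe-≡ {d = R} {R′} (map-not-injective R≡R′)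
  ... | refl , q≡q′ | refl | refl = refl , q≡q′

  length-glue : (Ls : Vec (DyckLe l) k) (Rs : Vec (DyckLe r) k) →
                let w = sumSemilengths Ls + sumSemilengths Rs + k in
                length (glue Ls Rs q) ≡ w + w + length q
  length-glue [] [] = refl
  length-glue {k = suc k} {q = q} (L ∷ Ls) (R ∷ Rs) = begin
    length (map not R′ ++ true ∷ L′ ++ false ∷ glue Ls Rs q)
      ≡⟨ length-++ (map not R′) ⟩
    length (map not R′) + suc (length (L′ ++ false ∷ glue Ls Rs q))
      ≡⟨ cong₂ (λ a b → a + suc b) (trans (length-map not R′) (dyckLe-length R)) (length-++ L′) ⟩
    (sR + sR) + suc (length L′ + suc (length (glue Ls Rs q)))
      ≡⟨ cong₂ (λ a b → (sR + sR) + suc (a + suc b)) (dyckLe-length L) (length-glue Ls Rs) ⟩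
    (sR + sR) + suc ((sL + sL) + suc ((ΣL + ΣR + k) + (ΣL + ΣR + k) + length q))
      ≡⟨ regroup sR sL ΣL ΣR k (length q) ⟩
    (sL + ΣL) + (sR + ΣR) + suc k + ((sL + ΣL) + (sR + ΣR) + suc k) + length q ∎
    where
    open ≡-Reasoning
    L′ = proj₁ L
    R′ = proj₁ R
    sL = semilength L′
    sR = semilength R′
    ΣL = sumSemilengths Ls
    ΣR = sumSemilengths Rs
    regroup : ∀ a b c d m x →
              (a + a) + suc ((b + b) + suc ((c + d + m) + (c + d + m) + x)) ≡
              (b + c) + (a + d) + suc m + ((b + c) + (a + d) + suc m) + x
    regroup = solve-∀

  semilength-++-glue : (Ls : Vec (DyckLe l) k) (Rs : Vec (DyckLe r) k) → ∀ p →
                      semilength (p ++ glue Ls Rs q) ≡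
                      sumSemilengths Ls + sumSemilengths Rs + semilength (p ++ q) + k
  semilength-++-glue {k} {q} Ls Rs p = begin
    ⌊ length (p ++ glue Ls Rs q) /2⌋    ≡⟨ cong ⌊_/2⌋ length≡ ⟩
    ⌊ w + w + length (p ++ q) /2⌋      ≡⟨ ⌊k+k+n/2⌋≡k+⌊n/2⌋ w _ ⟩
    w + semilength (p ++ q)             ≡⟨ regroup (sumSemilengths Ls) (sumSemilengths Rs) k _ ⟩
    sumSemilengths Ls + sumSemilengths Rs + semilength (p ++ q) + k ∎
    where
    open ≡-Reasoning
    w = sumSemilengths Ls + sumSemilengths Rs + k
    shuffle : ∀ a w b → a + (w + w + b) ≡ w + w + (a + b)
    shuffle = solve-∀
    length≡ : length (p ++ glue Ls Rs q) ≡ w + w + length (p ++ q)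
    length≡ = begin
      length (p ++ glue Ls Rs q)       ≡⟨ length-++ p ⟩
      length p + length (glue Ls Rs q) ≡⟨ cong (length p +_) (length-glue Ls Rs) ⟩
      length p + (w + w + length q)    ≡⟨ shuffle (length p) w (length q) ⟩
      w + w + (length p + length q)    ≡⟨ cong (w + w +_) (sym (length-++ p)) ⟩
      w + w + length (p ++ q)          ∎
    regroup : ∀ a b k s → a + b + k + s ≡ a + b + s + k
    regroup = solve-∀

  insert : FirstVisit r r 0 0 p → Vec (DyckLe l) k → Vec (DyckLe r) k → Path
  insert v Ls Rs = before v ++ glue Ls Rs (after v)

  insert-within : (v : FirstVisit r r 0 0 p) (Ls : Vec (DyckLe l) k) (Rs : Vec (DyckLe r) k) →
                  Within H 0 0 (insert v Ls Rs)
  insert-within v Ls Rs =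
    within-++ (within-mono (<⇒≤ r<H) (firstPassage⇒within (first-passage v)))
              (glue-within Ls Rs (after-within v))

  semilength-insert : (v : FirstVisit r r 0 0 p) (Ls : Vec (DyckLe l) k) (Rs : Vec (DyckLe r) k) →
                      semilength (insert v Ls Rs) ≡ sumSemilengths Ls + sumSemilengths Rs + semilength p + k
  semilength-insert {k = k} v Ls Rs =
    trans (semilength-++-glue Ls Rs (before v))
      (cong (λ p → sumSemilengths Ls + sumSemilengths Rs + semilength p + k) (splits v))

  insert-≡ : ∀ {a b} (v : FirstVisit r r 0 0 p) (Ls : Vec (DyckLe l) k) (Rs : Vec (DyckLe r) k) →
             FirstPassage r 0 a → a ++ b ≡ p → insert v Ls Rs ≡ a ++ glue Ls Rs b
  insert-≡ v Ls Rs f eq with firstVisit-unique v f eq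
  ... | refl , refl = refl

  insert-injective : (v : FirstVisit r r 0 0 p) (Ls : Vec (DyckLe l) k) (Rs : Vec (DyckLe r) k)
                     (v′ : FirstVisit r r 0 0 p′) (Ls′ : Vec (DyckLe l) k′) (Rs′ : Vec (DyckLe r) k′) →
                     insert v Ls Rs ≡ insert v′ Ls′ Rs′ →
                     _≡_ {A = Excursions} (k , Ls , Rs) (k′ , Ls′ , Rs′) × p ≡ p′
  insert-injective v Ls Rs v′ Ls′ Rs′ eq
    with firstPassage-unique (first-passage v) (first-passage v′) eq
  ... | before≡ , glue≡ with glue-injective Ls Rs Ls′ Rs′ (after-within v) (after-within v′) glue≡
  ... | excursions≡ , after≡ =
    excursions≡ , trans (sym (splits v)) (trans (cong₂ _++_ before≡ after≡) (splits v′))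

module Bijection (g : ℕ) where

  r l : ℕ
  r = ⌈ g /2⌉
  l = ⌊ g /2⌋

  open Decomposition r l

  H≡1+g : H ≡ suc g
  H≡1+g = trans (+-suc l r) (cong suc (⌊n/2⌋+⌈n/2⌉≡n g))

  dyckNLe⇒within : (x : DyckNLe n (suc g)) → Within H 0 0 (proj₁ x)
  dyckNLe⇒within (p , i , _ , h) = dyck⇒within 0 p i (subst (height p ≤_) (sym H≡1+g) h)

  within⇒dyckNLe : Within H 0 0 p → semilength p ≡ n → DyckNLe n (suc g)
  within⇒dyckNLe {p} w s with within⇒dyck z≤n w
  ... | i , h = p , i , s , subst (height p ≤_) H≡1+g h

  MCond-exact : height p ≡ r → MCond g k p
  MCond-exact {k = zero}  = ≤-reflexive
  MCond-exact {k = suc k} h≡r = h≡r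

  MCond-irrelevant : (c c′ : MCond g k p) → c ≡ c′
  MCond-irrelevant {k = zero}  = ≤-irrelevant
  MCond-irrelevant {k = suc k} = ≡-irrelevant

  excursionsOf : Quadruple n g → Excursions
  excursionsOf (k , Ls , Rs , _) = k , Ls , Rs

  pathM : Quadruple n g → Path
  pathM (_ , _ , _ , (M , _) , _) = M

  Quadruple-≡ : {x x′ : Quadruple n g} →
                excursionsOf x ≡ excursionsOf x′ → pathM x ≡ pathM x′ → x ≡ x′
  Quadruple-≡ {x = k , Ls , Rs , (M , i , c) , e} {x′ = .k , .Ls , .Rs , (.M , i′ , c′) , e′} refl refl
    rewrite T-irrelevant i i′ | MCond-irrelevant {k} c c′ | ≡-irrelevant e e′ = refl

  firstPassage-++-dyck : ∀ {a b} → FirstPassage r 0 a → Within r r 0 b →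
                         T (isDyck (a ++ b)) × height (a ++ b) ≡ r
  firstPassage-++-dyck f w with within⇒dyck z≤n (within-++ (firstPassage⇒within f) w)
  ... | i , h≤r = i , ≤-antisym h≤r (firstPassage-reaches f)

  exact⇒firstVisit : ∀ M → T (isDyck M) → height M ≡ r → FirstVisit r r 0 0 M
  exact⇒firstVisit M i h≡r =
    reaches⇒firstVisit (≤-reflexive (sym h≡r)) z≤n (dyck⇒within 0 M i (≤-reflexive h≡r))

  Split : Path → Set
  Split p = heightFrom 0 p < r ⊎ FirstVisit H r 0 0 p

  to-factorised : ∀ {a} → FirstPassage r 0 a → Factorisation q → semilength (a ++ q) ≡ n → Quadruple n g
  to-factorised {a = a} f (factorisation {k} Ls Rs {b} wb glued) s =
    k , Ls , Rs , (a ++ b , i , MCond-exact h≡r) ,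
    trans (sym (semilength-++-glue Ls Rs a)) (trans (cong (λ q → semilength (a ++ q)) glued) s)
    where
    i   = proj₁ (firstPassage-++-dyck f wb)
    h≡r = proj₂ (firstPassage-++-dyck f wb)

  to-split : (x : DyckNLe n (suc g)) → Split (proj₁ x) → Quadruple n g
  to-split (p , i , s , h) (inj₁ below) = 0 , [] , [] , (p , i , <⇒≤ below) , trans (+-identityʳ _) s
  to-split (_ , i , s , h) (inj₂ (firstVisit f w refl)) = to-factorised f (factorise ≤-refl [] w) s

  to : DyckNLe n (suc g) → Quadruple n g
  to x = to-split x (firstVisit? z≤n (dyckNLe⇒within x))

  from : Quadruple n g → DyckNLe n (suc g)
  from (zero , [] , [] , (M , i , c) , e) =
    within⇒dyckNLe (within-mono (<⇒≤ r<H) (dyck⇒within 0 M i c)) (trans (sym (+-identityʳ _)) e)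
  from (suc k , Ls , Rs , (M , i , c) , e) =
    within⇒dyckNLe (insert-within v Ls Rs) (trans (semilength-insert v Ls Rs) e)
    where
    v = exact⇒firstVisit M i c

  from∘to-factorised : ∀ {a} (f : FirstPassage r 0 a) (F : Factorisation q)
                       (s : semilength (a ++ q) ≡ n) →
                       proj₁ (from (to-factorised f F s)) ≡ a ++ q
  from∘to-factorised {a = a} f (factorisation [] [] wb glued) s = cong (a ++_) glued
  from∘to-factorised {a = a} f (factorisation (L ∷ Ls) (R ∷ Rs) {b} wb glued) s =
    trans (insert-≡ (exact⇒firstVisit (a ++ b) _ _) (L ∷ Ls) (R ∷ Rs) f refl) (cong (a ++_) glued)

  from∘to-split : (x : DyckNLe n (suc g)) (v : Split (proj₁ x)) →
                  from (to-split x v) ≡ x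
  from∘to-split (p , i , s , h) (inj₁ _) = DyckNLe-≡ refl
  from∘to-split (_ , i , s , h) (inj₂ (firstVisit f w refl)) =
    DyckNLe-≡ (from∘to-factorised f (factorise ≤-refl [] w) s)

  from∘to : (x : DyckNLe n (suc g)) → from (to x) ≡ x
  from∘to x = from∘to-split x (firstVisit? z≤n (dyckNLe⇒within x))

  from-injective : (x x′ : Quadruple n g) → proj₁ (from x) ≡ proj₁ (from x′) → x ≡ x′
  from-injective (zero , [] , [] , _) (zero , [] , [] , _) eq = Quadruple-≡ refl eq
  from-injective (zero , [] , [] , (M , i , c) , _) (suc k , L ∷ Ls , R ∷ Rs , (M′ , i′ , c′) , _) eq =
    ⊥-elim (glue-escapes L R Ls Rs (firstPassage⇒within (first-passage (exact⇒firstVisit M′ i′ c′)))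
                                    (subst (Within r 0 0) eq (dyck⇒within 0 M i c)))
  from-injective (suc k , L ∷ Ls , R ∷ Rs , (M , i , c) , _) (zero , [] , [] , (M′ , i′ , c′) , _) eq =
    ⊥-elim (glue-escapes L R Ls Rs (firstPassage⇒within (first-passage (exact⇒firstVisit M i c)))
                                    (subst (Within r 0 0) (sym eq) (dyck⇒within 0 M′ i′ c′)))
  from-injective (suc k , Ls , Rs , (M , i , c) , _) (suc k′ , Ls′ , Rs′ , (M′ , i′ , c′) , _) eq
    with insert-injective (exact⇒firstVisit M i c) Ls Rs (exact⇒firstVisit M′ i′ c′) Ls′ Rs′ eq
  ... | refl , M≡M′ = Quadruple-≡ refl M≡M′

  to∘from : (x : Quadruple n g) → to (from x) ≡ x
  to∘from x = from-injective (to (from x)) x (cong proj₁ (from∘to (from x)))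

lemma3p10 : (n g : ℕ) → DyckNLe n (suc g) ⤖ Quadruple n g
lemma3p10 n g = ↔⇒⤖ (mk↔ₛ′ to from to∘from from∘to)
  where
  open Bijection g
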